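{- Let $T$ be a tree with diameter $d$, and let $k$ be an integer with $1\le k\le d-1$. Then the $k$th power $T^k$ contains a $(k+1)^+$-branching spanning tree.
   Context: All graphs are finite, simple, connected and undirected. In a tree, vertices of degree $1$ are leaves and all other vertices are internal vertices. For an integer $m$, a tree is $m^+$-branching if every internal vertex has degree at least $m$. The diameter of a graph is the maximum distance between two of its vertices. For an integer $k\ge 1$, the $k$th power $G^k$ of a graph $G$ is the graph on $V(G)$ in which distinct $u,v$ are adjacent iff $d_G(u,v)\le k$. -}

module Defs where

open import Level using (0ℓ)
open import Data.Nat using (ℕ; zero; suc; _≤_)
open import Data.Fin using (Fin)
open import Data.List using (List; []; _∷_)
open import Data.List.Relation.Unary.Unique.Propositional using (Unique)
open import Data.Product using (Σ; ∃; ∃-syntax; _×_)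
open import Relation.Nullary using (¬_)
open import Data.Empty using (⊥)
open import Relation.Binary.PropositionalEquality using (_≡_; _≢_)
open import Function.Definitions using (Injective)

Rel : ℕ → Set₁
Rel n = Fin n → Fin n → Set

IsGraph : ∀ {n} → Rel n → Set
IsGraph {n} E = (∀ u v → E u v → E v u) × (∀ u → ¬ E u u)

data Walk {n} (E : Rel n) : Fin n → Fin n → ℕ → Set where
  nil  : ∀ {u} → Walk E u u 0
  cons : ∀ {u w v ℓ} → E u w → Walk E w v ℓ → Walk E u v (suc ℓ)

verts : ∀ {n} {E : Rel n} {u v ℓ} → Walk E u v ℓ → List (Fin n)
verts {u = u} nil = u ∷ []
verts {u = u} (cons _ p) = u ∷ verts p

Connected : ∀ {n} → Rel n → Set
Connected {n} E = ∀ (u v : Fin n) → ∃[ ℓ ] Walk E u v ℓ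

-- no cycle: an edge uv together with a path (distinct vertices) from v back
-- to u of length ≥ 2 would form a cycle of length ≥ 3
Acyclic : ∀ {n} → Rel n → Set
Acyclic {n} E = ∀ (u v : Fin n) (ℓ : ℕ) → E u v → (p : Walk E v u ℓ) →
                Unique (verts p) → 2 ≤ ℓ → ⊥

IsTree : ∀ {n} → Rel n → Set
IsTree E = IsGraph E × Connected E × Acyclic E

Dist : ∀ {n} → Rel n → Fin n → Fin n → ℕ → Set
Dist E u v m = Walk E u v m × (∀ ℓ → Walk E u v ℓ → m ≤ ℓ)

Diameter : ∀ {n} → Rel n → ℕ → Set
Diameter {n} E d = (∀ (u v : Fin n) m → Dist E u v m → m ≤ d)
                 × (∃[ u ] ∃[ v ] Dist E u v d)

Power : ∀ {n} → Rel n → ℕ → Rel n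
Power E k u v = u ≢ v × (∃[ ℓ ] (ℓ ≤ k × Walk E u v ℓ))

Subgraph : ∀ {n} → Rel n → Rel n → Set
Subgraph {n} S H = ∀ (u v : Fin n) → S u v → H u v

DegAtLeast : ∀ {n} → Rel n → Fin n → ℕ → Set
DegAtLeast {n} E v m = Σ (Fin m → Fin n) λ f → Injective _≡_ _≡_ f × (∀ i → E v (f i))

Leaf : ∀ {n} → Rel n → Fin n → Set
Leaf E v = DegAtLeast E v 1 × ¬ DegAtLeast E v 2

Branching : ∀ {n} → ℕ → Rel n → Set
Branching {n} m E = ∀ (v : Fin n) → ¬ Leaf E v → DegAtLeast E v m

{-# OPTIONS --safe #-}
-- Root T at a vertex ρ and let height x be the height of x once every vertex
-- below x whose height reaches k has been cut down to a leaf; hubs are the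
-- vertices other than ρ of height k.  Joining each y ≠ ρ to its nearest proper
-- ancestor that is ρ or a hub gives a spanning tree S of T^k: counting hubs as
-- 0, the height stays below k and increases strictly on the way up to that
-- ancestor, which is therefore at most k steps away.  A vertex that is neither ρ
-- nor a hub has no S-children, so it is a leaf of S.  A hub has a descending
-- path of length k below it with no hub strictly inside, whose k lower vertices
-- all attach to the hub; with its own S-parent that makes k + 1 neighbours.
-- Taking ρ at distance k from the end x₀ of a diametral path x₀ … y₀, the branch
-- of x₀ has depth at most k, hence no hub, so x₀ and its ancestors below ρ
-- attach to ρ, and so does the neighbour of ρ towards y₀.
module Submission where

open import Defs
open import Data.Nat using (ℕ; zero; suc; _≤_; _<_; _∸_; _+_; z≤n; s≤s)
open import Data.Nat.Properties
  using ( ≤-refl; ≤-reflexive; ≤-trans; ≤-antisym; ≤-pred; ≤∧≢⇒<; <⇒≤; <⇒≢; <⇒≱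
        ; <-irrefl; <-asym; <-trans; n≤1+n; n≢0⇒n>0; suc-injective; m<1+n⇒m<n∨m≡n
        ; +-comm; +-suc; +-identityʳ; +-monoˡ-≤; +-monoʳ-≤; +-mono-<-≤; +-cancelˡ-≤
        ; +-cancelʳ-≤; +-cancelʳ-≡; m+n≤o⇒m≤o; m+n≤o⇒n≤o; m<m+n; m<n+m
        ; m∸n≤m; m∸[m∸n]≡n; m+[n∸m]≡n; m<n⇒0<n∸m; n∸n≡0; +-∸-assoc; ∸-monoʳ-<
        ; ∸-cancelˡ-≡; module ≤-Reasoning )
  renaming (_≟_ to _≟ℕ_)
open import Data.Fin using (Fin; zero; suc; toℕ)
open import Data.Fin.Properties using (_≟_; toℕ<n; toℕ-injective)
open import Data.List using ([]; _∷_; length; allFin)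
open import Data.List.Properties using (∷-injectiveˡ; ∷-injectiveʳ)
open import Data.List.Extrema.Nat using (argmax; f[xs]≤f[argmax])
open import Data.List.Membership.Propositional using (_∈_; _∉_)
open import Data.List.Membership.Propositional.Properties using (∈-allFin)
open import Data.List.Relation.Binary.Subset.Propositional using (_⊆_)
open import Data.List.Relation.Unary.All using ([]; lookup)
open import Data.List.Relation.Unary.All.Properties using (¬Any⇒All¬)
open import Data.List.Relation.Unary.AllPairs using ([]; _∷_; tail)
open import Data.List.Relation.Unary.Any using (here; there)
open import Data.List.Relation.Unary.Unique.Propositional using (Unique)
open import Data.List.Relation.Unary.Unique.Propositional.Properties using (Unique[x∷xs]⇒x∉xs)
open import Data.Product using (Σ; ∃-syntax; _×_; _,_; proj₁; proj₂)
open import Data.Sum using (_⊎_; inj₁; inj₂; [_,_])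
open import Data.Empty using (⊥; ⊥-elim)
open import Function using (_∘_; case_of_)
open import Function.Definitions using (Injective)
open import Relation.Nullary using (¬_; Dec; yes; no; ¬?)
open import Relation.Nullary.Decidable using (_×-dec_; _⊎-dec_)
open import Relation.Binary.PropositionalEquality
  using (_≡_; _≢_; refl; sym; trans; cong; subst; module ≡-Reasoning)

Unique-∷⁺ : ∀ {A : Set} {x : A} {xs} → x ∉ xs → Unique xs → Unique (x ∷ xs)
Unique-∷⁺ {xs = xs} x∉xs xs! = ¬Any⇒All¬ xs x∉xs ∷ xs!

module _ {n : ℕ} {E : Rel n} where

  _++ʷ_ : ∀ {u w v a b} → Walk E u w a → Walk E w v b → Walk E u v (a + b)
  nil ++ʷ q = q
  cons e p ++ʷ q = cons e (p ++ʷ q)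

  splitWalk : ∀ a {b u v} → Walk E u v (a + b) → ∃[ w ] (Walk E u w a × Walk E w v b)
  splitWalk zero p = _ , nil , p
  splitWalk (suc a) (cons e p) with splitWalk a p
  ... | w , p₁ , p₂ = w , cons e p₁ , p₂

  snoc : ∀ {u w v ℓ} → Walk E u w ℓ → E w v → Walk E u v (suc ℓ)
  snoc nil e = cons e nil
  snoc (cons e′ p) e = cons e′ (snoc p e)

  reverse : (∀ u v → E u v → E v u) → ∀ {u v ℓ} → Walk E u v ℓ → Walk E v u ℓ
  reverse E-sym nil = nil
  reverse E-sym (cons e p) = snoc (reverse E-sym p) (E-sym _ _ e)

  length-zero : ∀ {u v ℓ} → Walk E u v ℓ → ℓ ≡ 0 → u ≡ v
  length-zero nil _ = refl

  length>0 : ∀ {u v ℓ} → Walk E u v ℓ → u ≢ v → 0 < ℓ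
  length>0 nil u≢v = ⊥-elim (u≢v refl)
  length>0 (cons _ _) _ = s≤s z≤n

  second : ∀ {u v ℓ} → Walk E u v ℓ → Fin n
  second {u} nil = u
  second (cons {w = w} _ _) = w

  start∈verts : ∀ {u v ℓ} (p : Walk E u v ℓ) → u ∈ verts p
  start∈verts nil = here refl
  start∈verts (cons _ _) = here refl

  end∈verts : ∀ {u v ℓ} (p : Walk E u v ℓ) → v ∈ verts p
  end∈verts nil = here refl
  end∈verts (cons _ p) = there (end∈verts p)

  verts-∷ : ∀ {u v ℓ} (p : Walk E u v ℓ) → ∃[ xs ] verts p ≡ u ∷ xs
  verts-∷ nil = [] , refl
  verts-∷ (cons _ p) = verts p , refl

  verts-length : ∀ {u v ℓ} (p : Walk E u v ℓ) → length (verts p) ≡ suc ℓ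
  verts-length nil = refl
  verts-length (cons _ p) = cong suc (verts-length p)

  second-cong : ∀ {u v v′ ℓ ℓ′} (p : Walk E u v ℓ) (q : Walk E u v′ ℓ′) →
                verts p ≡ verts q → second p ≡ second q
  second-cong nil nil _ = refl
  second-cong nil (cons _ q) eq = case trans (∷-injectiveʳ eq) (proj₂ (verts-∷ q)) of λ ()
  second-cong (cons _ p) nil eq = case trans (∷-injectiveʳ (sym eq)) (proj₂ (verts-∷ p)) of λ ()
  second-cong (cons _ p) (cons _ q) eq =
    ∷-injectiveˡ (trans (sym (proj₂ (verts-∷ p))) (trans (∷-injectiveʳ eq) (proj₂ (verts-∷ q))))

  IsPath : ∀ {u v ℓ} → Walk E u v ℓ → Set
  IsPath p = Unique (verts p)

  suffix : ∀ {u v ℓ x} (p : Walk E u v ℓ) → IsPath p → x ∈ verts p →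
           ∃[ ℓ′ ] Σ (Walk E x v ℓ′) λ q → IsPath q × verts q ⊆ verts p
  suffix nil p! (here refl) = 0 , nil , p! , λ x∈ → x∈
  suffix (cons e p) p! (here refl) = _ , cons e p , p! , λ x∈ → x∈
  suffix (cons e p) p! (there x∈) with suffix p (tail p!) x∈
  ... | ℓ′ , q , q! , q⊆ = ℓ′ , q , q! , λ y∈ → there (q⊆ y∈)

  prefix : ∀ {u v ℓ x} (p : Walk E u v ℓ) → IsPath p → x ∈ verts p →
           ∃[ ℓ′ ] Σ (Walk E u x ℓ′) λ q → IsPath q × verts q ⊆ verts p
  prefix nil p! (here refl) = 0 , nil , p! , λ x∈ → x∈
  prefix (cons e p) p! (here refl) = 0 , nil , [] ∷ [] , λ { (here refl) → here refl }
  prefix (cons e p) p! (there x∈) with prefix p (tail p!) x∈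
  ... | ℓ′ , q , q! , q⊆ =
    suc ℓ′ , cons e q , Unique-∷⁺ (λ u∈ → Unique[x∷xs]⇒x∉xs p! (q⊆ u∈)) q! ,
    λ { (here refl) → here refl ; (there y∈) → there (q⊆ y∈) }

  open import Data.List.Membership.DecPropositional (_≟_ {n}) using (_∈?_)

  toPath : ∀ {u v ℓ} → Walk E u v ℓ → ∃[ ℓ′ ] Σ (Walk E u v ℓ′) IsPath
  toPath nil = 0 , nil , [] ∷ []
  toPath {u} (cons e p) with toPath p
  ... | ℓ′ , q , q! with u ∈? verts q
  ...   | yes u∈ = let (ℓ″ , r , r! , _) = suffix q q! u∈ in ℓ″ , r , r!
  ...   | no u∉ = suc ℓ′ , cons e q , Unique-∷⁺ u∉ q!

  -- If the second vertices p ≠ q of the two paths differ, either p lies on the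
  -- second path, which then closes a cycle through the edge a p, or, by
  -- induction, the tail of the first path is the path p a q … and repeats a.
  module _ (E-sym : ∀ u v → E u v → E v u) (E-irrefl : ∀ u → ¬ E u u) (acyclic : Acyclic E) where

    path-unique : ∀ {a b ℓ ℓ′} (P : Walk E a b ℓ) (Q : Walk E a b ℓ′) →
                  IsPath P → IsPath Q → verts P ≡ verts Q
    path-unique nil nil _ _ = refl
    path-unique nil (cons _ Q) _ Q! = ⊥-elim (Unique[x∷xs]⇒x∉xs Q! (end∈verts Q))
    path-unique (cons _ P) nil P! _ = ⊥-elim (Unique[x∷xs]⇒x∉xs P! (end∈verts P))
    path-unique {a} (cons {w = p} e P) (cons {w = q} e′ Q) P! Q! with p ≟ q
    ... | yes refl = cong (a ∷_) (path-unique P Q (tail P!) (tail Q!))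
    ... | no p≢q with p ∈? verts Q
    ...   | yes p∈Q =
      let (ℓ″ , R , R! , R⊆) = prefix Q (tail Q!) p∈Q
          a∉R = λ a∈ → Unique[x∷xs]⇒x∉xs Q! (R⊆ a∈)
      in ⊥-elim (acyclic p a (suc ℓ″) (E-sym a p e) (cons e′ R) (Unique-∷⁺ a∉R R!)
                         (s≤s (length>0 R (p≢q ∘ sym))))
    ...   | no p∉Q with path-unique P (cons (E-sym a p e) (cons e′ Q)) (tail P!) (Unique-∷⁺ p∉aQ Q!)
      where
      p∉aQ : p ∉ a ∷ verts Q
      p∉aQ (here refl) = E-irrefl a e
      p∉aQ (there p∈Q) = p∉Q p∈Q
    ... | P≡ = ⊥-elim (Unique[x∷xs]⇒x∉xs P! (subst (a ∈_) (sym P≡) (there (here refl))))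

    path-length-unique : ∀ {a b ℓ ℓ′} (P : Walk E a b ℓ) (Q : Walk E a b ℓ′) →
                         IsPath P → IsPath Q → ℓ ≡ ℓ′
    path-length-unique P Q P! Q! =
      suc-injective (trans (sym (verts-length P))
        (trans (cong length (path-unique P Q P! Q!)) (verts-length Q)))

module Rooted {n : ℕ} {T : Rel n} (tree : IsTree T) (ρ : Fin n) where

  private
    T-sym : ∀ u v → T u v → T v u
    T-sym = proj₁ (proj₁ tree)

    T-irrefl : ∀ u → ¬ T u u
    T-irrefl = proj₂ (proj₁ tree)

    T-connected : Connected T
    T-connected = proj₁ (proj₂ tree)

    T-acyclic : Acyclic T
    T-acyclic = proj₂ (proj₂ tree)

  open import Data.List.Membership.DecPropositional (_≟_ {n}) using (_∈?_)

  opaque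
    rootPath : ∀ y → ∃[ ℓ ] Σ (Walk T y ρ ℓ) IsPath
    rootPath y = toPath (proj₂ (T-connected y ρ))

  depth : Fin n → ℕ
  depth y = proj₁ (rootPath y)

  rootWalk : ∀ y → Walk T y ρ (depth y)
  rootWalk y = proj₁ (proj₂ (rootPath y))

  rootWalk-isPath : ∀ y → IsPath (rootWalk y)
  rootWalk-isPath y = proj₂ (proj₂ (rootPath y))

  parent : Fin n → Fin n
  parent y = second (rootWalk y)

  depth-path : ∀ {y ℓ} (P : Walk T y ρ ℓ) → IsPath P → depth y ≡ ℓ
  depth-path {y} P P! =
    path-length-unique T-sym T-irrefl T-acyclic (rootWalk y) P (rootWalk-isPath y) P!

  depth-root : depth ρ ≡ 0
  depth-root = depth-path nil ([] ∷ [])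

  depth≡0⇒root : ∀ {y} → depth y ≡ 0 → y ≡ ρ
  depth≡0⇒root {y} = length-zero (rootWalk y)

  ≢root⇒depth>0 : ∀ {y} → y ≢ ρ → 0 < depth y
  ≢root⇒depth>0 y≢ρ = n≢0⇒n>0 (λ d≡0 → y≢ρ (depth≡0⇒root d≡0))

  depth>0⇒≢root : ∀ {y} → 0 < depth y → y ≢ ρ
  depth>0⇒≢root {y} d>0 refl = <⇒≢ d>0 (sym depth-root)

  private
    first-step : ∀ {y ℓ} (P : Walk T y ρ ℓ) → IsPath P → y ≢ ρ →
                 T y (second P) × ℓ ≡ suc (depth (second P))
    first-step nil _ y≢ρ = ⊥-elim (y≢ρ refl)
    first-step (cons e P) P! _ = e , cong suc (sym (depth-path P (tail P!)))

  parent-edge : ∀ {y} → y ≢ ρ → T y (parent y)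
  parent-edge {y} = proj₁ ∘ first-step (rootWalk y) (rootWalk-isPath y)

  depth-parent : ∀ {y} → y ≢ ρ → depth y ≡ suc (depth (parent y))
  depth-parent {y} = proj₂ ∘ first-step (rootWalk y) (rootWalk-isPath y)

  parent-path : ∀ {y w ℓ} → T y w → (P : Walk T w ρ ℓ) → IsPath P → y ∉ verts P →
                y ≢ ρ × parent y ≡ w
  parent-path {y} e P P! y∉P = (λ { refl → y∉P (end∈verts P) }) ,
    second-cong (rootWalk y) (cons e P)
      (path-unique T-sym T-irrefl T-acyclic (rootWalk y) (cons e P)
        (rootWalk-isPath y) (Unique-∷⁺ y∉P P!))

  edge-parent : ∀ {u v} → T u v → (u ≢ ρ × parent u ≡ v) ⊎ (v ≢ ρ × parent v ≡ u)
  edge-parent {u} {v} e with u ∈? verts (rootWalk v)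
  ... | no u∉ = inj₁ (parent-path e (rootWalk v) (rootWalk-isPath v) u∉)
  ... | yes u∈ = inj₂ (towards (rootWalk v) (rootWalk-isPath v) u∈)
    where
    towards : ∀ {ℓ} (P : Walk T v ρ ℓ) → IsPath P → u ∈ verts P → v ≢ ρ × parent v ≡ u
    towards nil _ (here refl) = ⊥-elim (T-irrefl _ e)
    towards (cons _ P) _ (here refl) = ⊥-elim (T-irrefl _ e)
    towards (cons _ P) P! (there u∈P) =
      let (_ , Q , Q! , Q⊆) = suffix P (tail P!) u∈P
      in parent-path (T-sym _ _ e) Q Q! (λ v∈Q → Unique[x∷xs]⇒x∉xs P! (Q⊆ v∈Q))

  edge-depth : ∀ {u w} → T u w → depth u ≤ suc (depth w)
  edge-depth e with edge-parent e
  ... | inj₁ (u≢ρ , refl) = ≤-reflexive (depth-parent u≢ρ)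
  ... | inj₂ (w≢ρ , refl) =
    ≤-trans (≤-trans (n≤1+n _) (≤-reflexive (sym (depth-parent w≢ρ)))) (n≤1+n _)

  depth-≤-walk : ∀ {u v ℓ} → Walk T u v ℓ → depth u ≤ ℓ + depth v
  depth-≤-walk nil = ≤-refl
  depth-≤-walk (cons e p) = ≤-trans (edge-depth e) (s≤s (depth-≤-walk p))

  below-parent : ∀ {i y} → suc i ≤ depth y → y ≢ ρ × i ≤ depth (parent y)
  below-parent i<d = y≢ρ , ≤-pred (subst (_ ≤_) (depth-parent y≢ρ) i<d)
    where y≢ρ = depth>0⇒≢root (≤-trans (s≤s z≤n) i<d)

  ancestor : ℕ → Fin n → Fin n
  ancestor zero y = y
  ancestor (suc i) y = ancestor i (parent y)

  ancestor-suc : ∀ i y → ancestor (suc i) y ≡ parent (ancestor i y)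
  ancestor-suc zero y = refl
  ancestor-suc (suc i) y = ancestor-suc i (parent y)

  depth-ancestor : ∀ i y → i ≤ depth y → depth (ancestor i y) ≡ depth y ∸ i
  depth-ancestor zero y _ = refl
  depth-ancestor (suc i) y i<d =
    let (y≢ρ , i≤dp) = below-parent i<d
    in trans (depth-ancestor i (parent y) i≤dp) (cong (_∸ suc i) (sym (depth-parent y≢ρ)))

  ancestorWalk : ∀ i y → i ≤ depth y → Walk T y (ancestor i y) i
  ancestorWalk zero y _ = nil
  ancestorWalk (suc i) y i<d =
    let (y≢ρ , i≤dp) = below-parent i<d in cons (parent-edge y≢ρ) (ancestorWalk i (parent y) i≤dp)

  branch : Fin n → Fin n
  branch y = ancestor (depth y ∸ 1) y

  SameBranch : Fin n → Fin n → Set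
  SameBranch u v = u ≢ ρ × v ≢ ρ × branch u ≡ branch v

  branch-parent : ∀ {y} → y ≢ ρ → parent y ≢ ρ → branch (parent y) ≡ branch y
  branch-parent {y} y≢ρ p≢ρ = begin
    ancestor (depth p ∸ 1) p            ≡⟨ cong (λ d → ancestor (d ∸ 1) p) (depth-parent p≢ρ) ⟩
    ancestor (suc (depth (parent p))) y ≡⟨ cong (λ d → ancestor d y) (depth-parent p≢ρ) ⟨
    ancestor (depth p) y                ≡⟨ cong (λ d → ancestor (d ∸ 1) y) (depth-parent y≢ρ) ⟨
    ancestor (depth y ∸ 1) y            ∎
    where
    open ≡-Reasoning
    p = parent y

  branch-ancestor : ∀ i y → i < depth y → branch (ancestor i y) ≡ branch y
  branch-ancestor zero y _ = refl
  branch-ancestor (suc i) y i<d =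
    let (y≢ρ , i<dp) = below-parent i<d
    in trans (branch-ancestor i (parent y) i<dp) (branch-parent y≢ρ (proj₁ (below-parent i<dp)))

  depth-branch : ∀ {y} → y ≢ ρ → depth (branch y) ≡ 1
  depth-branch {y} y≢ρ =
    trans (depth-ancestor (depth y ∸ 1) y (m∸n≤m _ 1)) (m∸[m∸n]≡n (≢root⇒depth>0 y≢ρ))

  branch-branch : ∀ {y} → y ≢ ρ → branch (branch y) ≡ branch y
  branch-branch {y} y≢ρ = cong (λ d → ancestor (d ∸ 1) (branch y)) (depth-branch y≢ρ)

  parent-branch : ∀ {y} → y ≢ ρ → parent (branch y) ≡ ρ
  parent-branch y≢ρ = depth≡0⇒root (suc-injective (trans (sym (depth-parent b≢ρ)) (depth-branch y≢ρ)))
    where b≢ρ = depth>0⇒≢root (≤-reflexive (sym (depth-branch y≢ρ)))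

  edge-branch : ∀ {u w} → T u w → u ≢ ρ → w ≢ ρ → branch u ≡ branch w
  edge-branch e u≢ρ w≢ρ with edge-parent e
  ... | inj₁ (_ , refl) = sym (branch-parent u≢ρ w≢ρ)
  ... | inj₂ (_ , refl) = branch-parent w≢ρ u≢ρ

  walk-through-root : ∀ {u v ℓ} → Walk T u v ℓ → depth u + depth v ≤ ℓ ⊎ SameBranch u v
  walk-through-root {u} p with u ≟ ρ
  walk-through-root {v = v} {ℓ} p | yes refl = inj₁ (begin
    depth ρ + depth v ≡⟨ cong (_+ depth v) depth-root ⟩
    depth v           ≤⟨ depth-≤-walk (reverse T-sym p) ⟩
    ℓ + depth ρ       ≡⟨ cong (ℓ +_) depth-root ⟩
    ℓ + 0             ≡⟨ +-identityʳ ℓ ⟩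
    ℓ                 ∎)
    where open ≤-Reasoning
  walk-through-root nil | no u≢ρ = inj₂ (u≢ρ , u≢ρ , refl)
  walk-through-root (cons {w = w} e p) | no u≢ρ with walk-through-root p
  ... | inj₁ short = inj₁ (≤-trans (+-monoˡ-≤ _ (edge-depth e)) (s≤s short))
  ... | inj₂ (w≢ρ , v≢ρ , same) = inj₂ (u≢ρ , v≢ρ , trans (edge-branch e u≢ρ w≢ρ) same)

  walkViaRoot : ∀ u v → Walk T u v (depth u + depth v)
  walkViaRoot u v = rootWalk u ++ʷ reverse T-sym (rootWalk v)

  dist-through-root : ∀ {u v} → ¬ SameBranch u v → Dist T u v (depth u + depth v)
  dist-through-root {u} {v} ¬same =
    walkViaRoot u v ,
    λ ℓ p → [ (λ short → short) , (λ same → ⊥-elim (¬same same)) ] (walk-through-root p)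

  ¬SameBranch-root : ∀ {u} → ¬ SameBranch u ρ
  ¬SameBranch-root (_ , ρ≢ρ , _) = ρ≢ρ refl

  same-branch-walk : ∀ {u v} → branch u ≡ branch v → Walk T u v ((depth u ∸ 1) + (depth v ∸ 1))
  same-branch-walk {u} {v} same =
    ancestorWalk (depth u ∸ 1) u (m∸n≤m _ 1) ++ʷ
    subst (λ x → Walk T x v _) (sym same) (reverse T-sym (ancestorWalk (depth v ∸ 1) v (m∸n≤m _ 1)))

  ancestor-induction : (P : Fin n → Set) →
                       (∀ {y} → y ≢ ρ → (parent y ≢ ρ → P (parent y)) → P y) →
                       ∀ {y} → y ≢ ρ → P y
  ancestor-induction P step {y} = go (depth y) y refl
    where
    go : ∀ d y → depth y ≡ d → y ≢ ρ → P y
    go zero y d≡0 y≢ρ = ⊥-elim (y≢ρ (depth≡0⇒root d≡0))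
    go (suc d) y d≡ y≢ρ =
      step y≢ρ (go d (parent y) (suc-injective (trans (sym (depth-parent y≢ρ)) d≡)))

module ParentGraph {n : ℕ} (ρ : Fin n) (up : Fin n → Fin n) (rank : Fin n → ℕ)
                   (rank-up : ∀ {x} → x ≢ ρ → rank (up x) < rank x) where

  UpEdge : Fin n → Fin n → Set
  UpEdge x y = x ≢ ρ × up x ≡ y

  Graph : Rel n
  Graph x y = UpEdge x y ⊎ UpEdge y x

  private
    UpEdge-rank : ∀ {x y} → UpEdge x y → rank y < rank x
    UpEdge-rank (x≢ρ , refl) = rank-up x≢ρ

    up-twice : ∀ {x w w′ y ℓ} (e : Graph x w) (e′ : Graph w w′) (p : Walk Graph w′ y ℓ) →
               IsPath (cons e (cons e′ p)) → UpEdge w x → UpEdge w w′ → ⊥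
    up-twice _ _ p p! (_ , refl) (_ , refl) =
      Unique[x∷xs]⇒x∉xs p! (there (start∈verts p))

  Graph-sym : ∀ x y → Graph x y → Graph y x
  Graph-sym _ _ = [ inj₂ , inj₁ ]

  Graph-irrefl : ∀ x → ¬ Graph x x
  Graph-irrefl x (inj₁ x↑) = <-irrefl refl (UpEdge-rank x↑)
  Graph-irrefl x (inj₂ x↑) = <-irrefl refl (UpEdge-rank x↑)

  walkToRoot : ∀ f x → rank x < f → ∃[ ℓ ] Walk Graph x ρ ℓ
  walkToRoot f x r< with x ≟ ρ
  ... | yes refl = 0 , nil
  walkToRoot (suc f) x r< | no x≢ρ with walkToRoot f (up x) (≤-trans (rank-up x≢ρ) (≤-pred r<))
  ... | ℓ , p = suc ℓ , cons (inj₁ (x≢ρ , refl)) p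

  Graph-connected : Connected Graph
  Graph-connected x y with walkToRoot _ x ≤-refl | walkToRoot _ y ≤-refl
  ... | _ , p | _ , q = _ , p ++ʷ reverse Graph-sym q

  penultimate : ∀ {x y ℓ} → Walk Graph x y ℓ → Fin n
  penultimate {x} nil = x
  penultimate {x} (cons _ nil) = x
  penultimate (cons _ (cons e p)) = penultimate (cons e p)

  penultimate∈verts : ∀ {x y ℓ} (p : Walk Graph x y (suc ℓ)) → penultimate p ∈ verts p
  penultimate∈verts (cons _ nil) = here refl
  penultimate∈verts (cons _ (cons e p)) = there (penultimate∈verts (cons e p))

  -- A path in the forest climbs and then descends.
  starts-up-or-descends : ∀ {x y ℓ} (p : Walk Graph x y (suc ℓ)) → IsPath p →
                          UpEdge x (second p) ⊎ (rank x < rank y × UpEdge y (penultimate p))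
  starts-up-or-descends (cons (inj₁ x↑) _) _ = inj₁ x↑
  starts-up-or-descends (cons (inj₂ w↑) nil) _ = inj₂ (UpEdge-rank w↑ , w↑)
  starts-up-or-descends (cons (inj₂ w↑) (cons e p)) p! with starts-up-or-descends (cons e p) (tail p!)
  ... | inj₁ w↑′ = ⊥-elim (up-twice (inj₂ w↑) e p p! w↑ w↑′)
  ... | inj₂ (r< , y↑) = inj₂ (<-trans (UpEdge-rank w↑) r< , y↑)

  ends-up-or-ascends : ∀ {x y ℓ} (p : Walk Graph x y (suc ℓ)) → IsPath p →
                       UpEdge y (penultimate p) ⊎ (rank y < rank x × UpEdge x (second p))
  ends-up-or-ascends (cons (inj₁ x↑) nil) _ = inj₂ (UpEdge-rank x↑ , x↑)
  ends-up-or-ascends (cons (inj₂ y↑) nil) _ = inj₁ y↑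
  ends-up-or-ascends (cons e (cons e′ p)) p! with ends-up-or-ascends (cons e′ p) (tail p!) | e
  ... | inj₁ y↑ | _ = inj₁ y↑
  ... | inj₂ (r< , _) | inj₁ x↑ = inj₂ (<-trans r< (UpEdge-rank x↑) , x↑)
  ... | inj₂ (_ , w↑′) | inj₂ w↑ = ⊥-elim (up-twice e e′ p p! w↑ w↑′)

  Graph-acyclic : Acyclic Graph
  Graph-acyclic _ _ 0 _ _ _ ()
  Graph-acyclic _ _ 1 _ _ _ (s≤s ())
  Graph-acyclic u v (suc (suc ℓ)) (inj₁ u↑) p@(cons _ q@(cons _ _)) p! _ with ends-up-or-ascends p p!
  ... | inj₁ u↑′ = Unique[x∷xs]⇒x∉xs p!
                     (subst (_∈ verts q) (trans (sym (proj₂ u↑′)) (proj₂ u↑)) (penultimate∈verts q))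
  ... | inj₂ (r< , _) = <-asym r< (UpEdge-rank u↑)
  Graph-acyclic u v (suc (suc ℓ)) (inj₂ v↑) p@(cons _ (cons _ r)) p! _ with starts-up-or-descends p p!
  ... | inj₁ v↑′ = Unique[x∷xs]⇒x∉xs (tail p!)
                     (subst (_∈ verts r) (trans (sym (proj₂ v↑)) (proj₂ v↑′)) (end∈verts r))
  ... | inj₂ (r< , _) = <-asym r< (UpEdge-rank v↑)

  Graph-tree : IsTree Graph
  Graph-tree = (Graph-sym , Graph-irrefl) , Graph-connected , Graph-acyclic

  childless-leaf : ∀ {x} → x ≢ ρ → (∀ y → ¬ UpEdge y x) → Leaf Graph x
  childless-leaf {x} x≢ρ childless =
    ((λ _ → up x) , (λ { {zero} {zero} _ → refl }) , λ _ → inj₁ (x≢ρ , refl)) ,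
    λ (f , f-inj , adj) → case f-inj (trans (only (adj zero)) (sym (only (adj (suc zero))))) of λ ()
    where
    only : ∀ {y} → Graph x y → y ≡ up x
    only (inj₁ (_ , refl)) = refl
    only (inj₂ y↑) = ⊥-elim (childless _ y↑)

extend-degree : ∀ {n} {E : Rel n} {v z m} (deg : DegAtLeast E v m) → E v z →
                (∀ i → proj₁ deg i ≢ z) → DegAtLeast E v (suc m)
extend-degree {n} {E} {v} {z} {m} (f , f-inj , adj) vz fresh = g , g-inj , g-adj
  where
  g : Fin (suc m) → Fin n
  g zero = z
  g (suc i) = f i

  g-inj : Injective _≡_ _≡_ g
  g-inj {zero} {zero} _ = refl
  g-inj {zero} {suc j} eq = ⊥-elim (fresh j (sym eq))
  g-inj {suc i} {zero} eq = ⊥-elim (fresh i eq)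
  g-inj {suc i} {suc j} eq = cong suc (f-inj eq)

  g-adj : ∀ i → E v (g i)
  g-adj zero = vz
  g-adj (suc i) = adj i

module HubTree {n : ℕ} {T : Rel n} (tree : IsTree T) (ρ : Fin n) (k : ℕ) (k≥1 : 1 ≤ k)
                    (h : ℕ) (depth≤h : ∀ y → Rooted.depth tree ρ y ≤ h) where

  open Rooted tree ρ

  Child : Fin n → Fin n → Set
  Child c x = c ≢ ρ × parent c ≡ x

  child? : ∀ c x → Dec (Child c x)
  child? c x = ¬? (c ≟ ρ) ×-dec (parent c ≟ x)

  reset : ℕ → ℕ
  reset m with m ≟ℕ k
  ... | yes _ = 0
  ... | no _ = m

  reset-< : ∀ {m} → m ≤ k → reset m < k
  reset-< {m} m≤k with m ≟ℕ k
  ... | yes _ = k≥1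
  ... | no m≢k = ≤∧≢⇒< m≤k m≢k

  reset-≤ : ∀ m → reset m ≤ m
  reset-≤ m with m ≟ℕ k
  ... | yes _ = z≤n
  ... | no _ = ≤-refl

  reset-k : reset k ≡ 0
  reset-k with k ≟ℕ k
  ... | yes _ = refl
  ... | no k≢k = ⊥-elim (k≢k refl)

  reset-≢ : ∀ {m} → m ≢ k → reset m ≡ m
  reset-≢ {m} m≢k with m ≟ℕ k
  ... | yes m≡k = ⊥-elim (m≢k m≡k)
  ... | no _ = refl

  weight : (Fin n → ℕ) → Fin n → Fin n → ℕ
  weight g x c with child? c x
  ... | yes _ = suc (reset (g c))
  ... | no _ = 0

  weight-child : ∀ g {x c} → Child c x → weight g x c ≡ suc (reset (g c))
  weight-child g {x} {c} ch with child? c x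
  ... | yes _ = refl
  ... | no ¬ch = ⊥-elim (¬ch ch)

  weight-positive : ∀ g x c → 0 < weight g x c → Child c x
  weight-positive g x c pos with child? c x
  ... | yes ch = ch
  weight-positive g x c () | no _

  heightWithin : ℕ → Fin n → ℕ
  heightWithin zero x = 0
  heightWithin (suc f) x = weight (heightWithin f) x (argmax (weight (heightWithin f) x) x (allFin n))

  -- reset cuts the tree below every vertex of height k.  The fuel suc h ∸ depth x
  -- suffices and drops by exactly one from a vertex to its children.
  height : Fin n → ℕ
  height x = heightWithin (suc h ∸ depth x) x

  heightWithin-≤ : ∀ f x → heightWithin f x ≤ k
  heightWithin-≤ zero x = z≤n
  heightWithin-≤ (suc f) x = weight-≤ (argmax (weight (heightWithin f) x) x (allFin n))
    where
    weight-≤ : ∀ c → weight (heightWithin f) x c ≤ k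
    weight-≤ c with child? c x
    ... | yes _ = reset-< (heightWithin-≤ f c)
    ... | no _ = z≤n

  height-≤ : ∀ x → height x ≤ k
  height-≤ x = heightWithin-≤ (suc h ∸ depth x) x

  private
    fuel-suc : ∀ x → suc h ∸ depth x ≡ suc (h ∸ depth x)
    fuel-suc x = +-∸-assoc 1 (depth≤h x)

    fuel-child : ∀ {c x} → Child c x → suc h ∸ depth c ≡ h ∸ depth x
    fuel-child {c} (c≢ρ , refl) = cong (suc h ∸_) (depth-parent c≢ρ)

    height-unfold : ∀ x → height x ≡ heightWithin (suc (h ∸ depth x)) x
    height-unfold x =
      cong (λ f → heightWithin f x) {suc h ∸ depth x} {suc (h ∸ depth x)} (fuel-suc x)

    height-child-fuel : ∀ {c x} → Child c x → heightWithin (h ∸ depth x) c ≡ height c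
    height-child-fuel {c} {x} ch =
      cong (λ f → heightWithin f c) {h ∸ depth x} {suc h ∸ depth c} (sym (fuel-child ch))

  height-parent : ∀ {c} → c ≢ ρ → suc (reset (height c)) ≤ height (parent c)
  height-parent {c} c≢ρ = begin
    suc (reset (height c))                 ≡⟨ cong (suc ∘ reset) (height-child-fuel (c≢ρ , refl)) ⟨
    suc (reset (heightWithin f c))         ≡⟨ weight-child (heightWithin f) (c≢ρ , refl) ⟨
    weight (heightWithin f) (parent c) c   ≤⟨ lookup (f[xs]≤f[argmax] {f = weight (heightWithin f) (parent c)}
                                                               (parent c) (allFin n)) (∈-allFin c) ⟩
    heightWithin (suc f) (parent c)        ≡⟨ height-unfold (parent c) ⟨
    height (parent c)                      ∎
    where
    open ≤-Reasoning
    f = h ∸ depth (parent c)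

  height-child : ∀ {x} → 0 < height x → ∃[ c ] (Child c x × height x ≡ suc (reset (height c)))
  height-child {x} pos = c , ch , (begin
    height x                               ≡⟨ height-unfold x ⟩
    weight (heightWithin f) x c            ≡⟨ weight-child (heightWithin f) ch ⟩
    suc (reset (heightWithin f c))         ≡⟨ cong (suc ∘ reset) (height-child-fuel ch) ⟩
    suc (reset (height c))                 ∎)
    where
    open ≡-Reasoning
    f = h ∸ depth x
    c = argmax (weight (heightWithin f) x) x (allFin n)
    ch = weight-positive (heightWithin f) x c (subst (0 <_) (height-unfold x) pos)

  Anchor : Fin n → Set
  Anchor x = x ≡ ρ ⊎ height x ≡ k

  anchor? : ∀ x → Dec (Anchor x)
  anchor? x = (x ≟ ρ) ⊎-dec (height x ≟ℕ k)

  climb : ℕ → Fin n → Fin n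
  climb zero y = ρ
  climb (suc f) y with anchor? (parent y)
  ... | yes _ = parent y
  ... | no _ = climb f (parent y)

  -- The nearest anchor strictly above y (ρ is an anchor, so depth y steps suffice).
  up : Fin n → Fin n
  up y = climb (depth y) y

  up-anchor : ∀ {y} → y ≢ ρ → Anchor (parent y) → up y ≡ parent y
  up-anchor {y} y≢ρ a = trans (cong (λ f → climb f y) (depth-parent y≢ρ)) climb-anchor
    where
    climb-anchor : climb (suc (depth (parent y))) y ≡ parent y
    climb-anchor with anchor? (parent y)
    ... | yes _ = refl
    ... | no ¬a = ⊥-elim (¬a a)

  up-skip : ∀ {y} → y ≢ ρ → ¬ Anchor (parent y) → up y ≡ up (parent y)
  up-skip {y} y≢ρ ¬a = trans (cong (λ f → climb f y) (depth-parent y≢ρ)) climb-skip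
    where
    climb-skip : climb (suc (depth (parent y))) y ≡ up (parent y)
    climb-skip with anchor? (parent y)
    ... | yes a = ⊥-elim (¬a a)
    ... | no _ = refl

  private
    parent≢root : ∀ {y} → ¬ Anchor (parent y) → parent y ≢ ρ
    parent≢root ¬a = ¬a ∘ inj₁

  up-is-anchor : ∀ {y} → y ≢ ρ → Anchor (up y)
  up-is-anchor = ancestor-induction (Anchor ∘ up) step
    where
    step : ∀ {y} → y ≢ ρ → (parent y ≢ ρ → Anchor (up (parent y))) → Anchor (up y)
    step {y} y≢ρ ih with anchor? (parent y)
    ... | yes a = subst Anchor (sym (up-anchor y≢ρ a)) a
    ... | no ¬a = subst Anchor (sym (up-skip y≢ρ ¬a)) (ih (parent≢root ¬a))

  up-depth : ∀ {y} → y ≢ ρ → depth (up y) < depth y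
  up-depth = ancestor-induction (λ y → depth (up y) < depth y) step
    where
    step : ∀ {y} → y ≢ ρ → (parent y ≢ ρ → depth (up (parent y)) < depth (parent y)) →
           depth (up y) < depth y
    step {y} y≢ρ ih with anchor? (parent y)
    ... | yes a =
      subst (λ x → depth x < depth y) (sym (up-anchor y≢ρ a)) (≤-reflexive (sym (depth-parent y≢ρ)))
    ... | no ¬a =
      subst (λ x → depth x < depth y) (sym (up-skip y≢ρ ¬a))
            (<-trans (ih (parent≢root ¬a)) (≤-reflexive (sym (depth-parent y≢ρ))))

  up-walk : ∀ {y} → y ≢ ρ → ∃[ ℓ ] (reset (height y) + ℓ ≤ k × Walk T y (up y) ℓ)
  up-walk = ancestor-induction P step
    where
    P : Fin n → Set
    P y = ∃[ ℓ ] (reset (height y) + ℓ ≤ k × Walk T y (up y) ℓ)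

    step : ∀ {y} → y ≢ ρ → (parent y ≢ ρ → P (parent y)) → P y
    step {y} y≢ρ ih with anchor? (parent y)
    ... | yes a = 1 , subst (_≤ k) (+-comm 1 _) (reset-< (height-≤ y)) ,
                  subst (λ z → Walk T y z 1) (sym (up-anchor y≢ρ a)) (cons (parent-edge y≢ρ) nil)
    ... | no ¬a with ih (parent≢root ¬a)
    ...   | ℓ , short , w =
      suc ℓ , shorter , subst (λ z → Walk T y z (suc ℓ)) (sym (up-skip y≢ρ ¬a)) (cons (parent-edge y≢ρ) w)
      where
      shorter : reset (height y) + suc ℓ ≤ k
      shorter = begin
        reset (height y) + suc ℓ            ≡⟨ +-suc _ ℓ ⟩
        suc (reset (height y)) + ℓ          ≤⟨ +-monoˡ-≤ ℓ (height-parent y≢ρ) ⟩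
        height (parent y) + ℓ               ≡⟨ cong (_+ ℓ) (reset-≢ (¬a ∘ inj₂)) ⟨
        reset (height (parent y)) + ℓ       ≤⟨ short ⟩
        k                                   ∎
        where open ≤-Reasoning

  Chain : ℕ → Fin n → Fin n → Set
  Chain j w x = ancestor j w ≡ x × depth w ≡ j + depth x ×
                (∀ i → 0 < i → i < j → height (ancestor i w) ≢ k)

  chain-start≢root : ∀ {j w x} → 0 < j → Chain j w x → w ≢ ρ
  chain-start≢root {suc j} _ (_ , depth-w , _) = depth>0⇒≢root (subst (0 <_) (sym depth-w) (s≤s z≤n))

  chain-extend : ∀ {j w c} → c ≢ ρ → (0 < j → height c ≢ k) → Chain j w c →
                 Chain (suc j) w (parent c)
  chain-extend {j} {w} {c} c≢ρ c-free (w↑ , depth-w , free) =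
    trans (ancestor-suc j w) (cong parent w↑) ,
    trans depth-w (trans (cong (j +_) (depth-parent c≢ρ)) (+-suc j _)) ,
    free′
    where
    free′ : ∀ i → 0 < i → i < suc j → height (ancestor i w) ≢ k
    free′ i 0<i i≤j with m<1+n⇒m<n∨m≡n i≤j
    ... | inj₁ i<j = free i 0<i i<j
    ... | inj₂ refl = subst (λ x → height x ≢ k) (sym w↑) (c-free 0<i)

  chain-tail : ∀ {j w x} → Chain (suc j) w x → Chain j (parent w) x
  chain-tail {j} chain@(w↑ , depth-w , free) =
    w↑ ,
    suc-injective (trans (sym (depth-parent (chain-start≢root (s≤s z≤n) chain))) depth-w) ,
    λ i 0<i i<j → free (suc i) (s≤s z≤n) (s≤s i<j)

  chain-below : ∀ j x → j ≤ height x → ∃[ w ] Chain j w x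
  chain-below zero x _ = x , refl , refl , λ _ _ ()
  chain-below (suc j) x j<h with height-child (≤-trans (s≤s z≤n) j<h)
  ... | c , (c≢ρ , refl) , h≡ =
    let (w , chain) = chain-below j c (≤-trans j≤reset (reset-≤ _))
    in w , chain-extend c≢ρ c-free chain
    where
    j≤reset = ≤-pred (subst (suc j ≤_) h≡ j<h)

    c-free : 0 < j → height c ≢ k
    c-free 0<j hk = case ≤-trans 0<j (subst (j ≤_) (trans (cong reset hk) reset-k) j≤reset) of λ ()

  chain-drop : ∀ i {j w x} → Chain (i + j) w x → Chain j (ancestor i w) x
  chain-drop zero chain = chain
  chain-drop (suc i) chain = chain-drop i (chain-tail chain)

  up-chain : ∀ {j w x} → Anchor x → 0 < j → Chain j w x → up w ≡ x
  up-chain {suc zero} x-anchor _ chain@(w↑ , _) =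
    trans (up-anchor (chain-start≢root (s≤s z≤n) chain) (subst Anchor (sym w↑) x-anchor)) w↑
  up-chain {suc (suc j)} {w} x-anchor _ chain@(_ , _ , free) =
    trans (up-skip (chain-start≢root (s≤s z≤n) chain) ¬anchor)
          (up-chain x-anchor (s≤s z≤n) (chain-tail chain))
    where
    ¬anchor : ¬ Anchor (parent w)
    ¬anchor (inj₁ p≡ρ) = chain-start≢root (s≤s z≤n) (chain-tail chain) p≡ρ
    ¬anchor (inj₂ hk) = free 1 (s≤s z≤n) (s≤s (s≤s z≤n)) hk

  open ParentGraph ρ up depth up-depth
    using (UpEdge; childless-leaf) renaming (Graph to S; Graph-tree to S-tree) public

  private
    up-power : ∀ {y} → y ≢ ρ → Power T k y (up y)
    up-power y≢ρ with up-walk y≢ρ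
    ... | ℓ , short , walk =
      (λ y≡ → <-irrefl (cong depth (sym y≡)) (up-depth y≢ρ)) , ℓ , m+n≤o⇒n≤o _ short , walk

  S-power : Subgraph S (Power T k)
  S-power _ _ (inj₁ (y≢ρ , refl)) = up-power y≢ρ
  S-power _ _ (inj₂ (y≢ρ , refl)) with up-power y≢ρ
  ... | y≢ , ℓ , ℓ≤k , walk = y≢ ∘ sym , ℓ , ℓ≤k , reverse T-sym walk
    where T-sym = proj₁ (proj₁ tree)

  link-chain : ∀ {i w a} → i < k → Chain k w a → Chain (k ∸ i) (ancestor i w) a
  link-chain {i} i<k chain =
    chain-drop i (subst (λ j → Chain j _ _) (sym (m+[n∸m]≡n (<⇒≤ i<k))) chain)

  link-deeper : ∀ {i w a} → i < k → Chain k w a → depth a < depth (ancestor i w)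
  link-deeper i<k chain =
    subst (_ <_) (sym (proj₁ (proj₂ (link-chain i<k chain)))) (m<n+m _ (m<n⇒0<n∸m i<k))

  chain-links : ∀ {w a} → Anchor a → Chain k w a → DegAtLeast S a k
  chain-links {w} {a} a-anchor chain =
    (λ i → ancestor (toℕ i) w) , link-injective , λ i → inj₂ (link-up (toℕ<n i))
    where
    link-up : ∀ {i} → i < k → UpEdge (ancestor i w) a
    link-up i<k = chain-start≢root (m<n⇒0<n∸m i<k) (link-chain i<k chain) ,
                  up-chain a-anchor (m<n⇒0<n∸m i<k) (link-chain i<k chain)

    link-injective : Injective _≡_ _≡_ (λ i → ancestor (toℕ i) w)
    link-injective {i} {j} eq =
      toℕ-injective (∸-cancelˡ-≡ (<⇒≤ i<k) (<⇒≤ j<k) (+-cancelʳ-≡ (depth a) _ _ (begin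
        (k ∸ toℕ i) + depth a       ≡⟨ proj₁ (proj₂ (link-chain i<k chain)) ⟨
        depth (ancestor (toℕ i) w)  ≡⟨ cong depth eq ⟩
        depth (ancestor (toℕ j) w)  ≡⟨ proj₁ (proj₂ (link-chain j<k chain)) ⟩
        (k ∸ toℕ j) + depth a       ∎)))
      where
      open ≡-Reasoning
      i<k = toℕ<n i
      j<k = toℕ<n j

  hub-degree : ∀ {x} → x ≢ ρ → height x ≡ k → DegAtLeast S x (suc k)
  hub-degree {x} x≢ρ hx with chain-below k x (≤-reflexive (sym hx))
  ... | w , chain = extend-degree {E = S} (chain-links (inj₂ hx) chain) (inj₁ (x≢ρ , refl)) fresh
    where
    fresh : ∀ i → ancestor (toℕ i) w ≢ up x
    fresh i eq =
      <-asym (up-depth x≢ρ) (subst (λ z → depth x < depth z) eq (link-deeper (toℕ<n i) chain))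

  S-branching : DegAtLeast S ρ (suc k) → Branching (suc k) S
  S-branching root-degree v ¬leaf with v ≟ ρ
  ... | yes refl = root-degree
  ... | no v≢ρ with height v ≟ℕ k
  ...   | yes hv = hub-degree v≢ρ hv
  ...   | no ¬hv = ⊥-elim (¬leaf (childless-leaf v≢ρ childless))
    where
    childless : ∀ y → ¬ UpEdge y v
    childless y (y≢ρ , refl) = [ v≢ρ , ¬hv ] (up-is-anchor y≢ρ)

module DiametralRoot {n : ℕ} {T : Rel n} (tree : IsTree T) (k e : ℕ) (k≥1 : 1 ≤ k) (e≥1 : 1 ≤ e)
                 (diameter : Diameter T (k + e)) where

  private
    bound : ∀ u v m → Dist T u v m → m ≤ k + e
    bound = proj₁ diameter

    x₀ y₀ : Fin n
    x₀ = proj₁ (proj₂ diameter)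
    y₀ = proj₁ (proj₂ (proj₂ diameter))

    W₀ : Walk T x₀ y₀ (k + e)
    W₀ = proj₁ (proj₂ (proj₂ (proj₂ diameter)))

    W₀-min : ∀ ℓ → Walk T x₀ y₀ ℓ → k + e ≤ ℓ
    W₀-min = proj₂ (proj₂ (proj₂ (proj₂ diameter)))

  ρ : Fin n
  ρ = proj₁ (splitWalk k W₀)

  private
    W₁ : Walk T x₀ ρ k
    W₁ = proj₁ (proj₂ (splitWalk k W₀))

    W₂ : Walk T ρ y₀ e
    W₂ = proj₂ (proj₂ (splitWalk k W₀))

  open Rooted tree ρ

  private
    depth-x₀-≤ : depth x₀ ≤ k
    depth-x₀-≤ with walk-through-root W₁
    ... | inj₁ short = m+n≤o⇒m≤o _ short
    ... | inj₂ (_ , ρ≢ρ , _) = ⊥-elim (ρ≢ρ refl)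

    depth-y₀-≤ : depth y₀ ≤ e
    depth-y₀-≤ with walk-through-root W₂
    ... | inj₁ short = m+n≤o⇒n≤o _ short
    ... | inj₂ (ρ≢ρ , _) = ⊥-elim (ρ≢ρ refl)

    diametral-via-root : k + e ≤ depth x₀ + depth y₀
    diametral-via-root = W₀-min _ (walkViaRoot x₀ y₀)

  depth-x₀ : depth x₀ ≡ k
  depth-x₀ = ≤-antisym depth-x₀-≤
    (+-cancelʳ-≤ e k (depth x₀) (≤-trans diametral-via-root (+-monoʳ-≤ (depth x₀) depth-y₀-≤)))

  depth-y₀ : depth y₀ ≡ e
  depth-y₀ = ≤-antisym depth-y₀-≤
    (+-cancelˡ-≤ k e (depth y₀) (≤-trans diametral-via-root (+-monoˡ-≤ (depth y₀) depth-x₀-≤)))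

  x₀≢ρ : x₀ ≢ ρ
  x₀≢ρ = depth>0⇒≢root (subst (0 <_) (sym depth-x₀) k≥1)

  y₀≢ρ : y₀ ≢ ρ
  y₀≢ρ = depth>0⇒≢root (subst (0 <_) (sym depth-y₀) e≥1)

  x₀-y₀-apart : ¬ SameBranch x₀ y₀
  x₀-y₀-apart (_ , _ , same) = <⇒≱ shortcut (W₀-min _ (same-branch-walk same))
    where
    shortcut : (depth x₀ ∸ 1) + (depth y₀ ∸ 1) < k + e
    shortcut rewrite depth-x₀ | depth-y₀ = +-mono-<-≤ (∸-monoʳ-< (s≤s z≤n) k≥1) (m∸n≤m e 1)

  depth-≤-diameter : ∀ y → depth y ≤ k + e
  depth-≤-diameter y = m+n≤o⇒m≤o _ (bound y ρ _ (dist-through-root ¬SameBranch-root))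

  open HubTree tree ρ k k≥1 (k + e) depth-≤-diameter public

  shallow-beside-x₀ : ∀ {z} → SameBranch z x₀ → depth z ≤ k
  shallow-beside-x₀ {z} (z≢ρ , _ , z~x₀) =
    +-cancelʳ-≤ e (depth z) k
      (subst (λ d → depth z + d ≤ k + e) depth-y₀ (bound z y₀ _ (dist-through-root apart)))
    where
    apart : ¬ SameBranch z y₀
    apart (_ , _ , z~y₀) = x₀-y₀-apart (x₀≢ρ , y₀≢ρ , trans (sym z~x₀) z~y₀)

  no-hub-beside-x₀ : ∀ {z} → SameBranch z x₀ → height z ≢ k
  no-hub-beside-x₀ {z} (z≢ρ , _ , z~x₀) hz with chain-below k z (≤-reflexive (sym hz))
  ... | w , chain@(w↑ , depth-w , _) =
    <⇒≱ k<depth-w (shallow-beside-x₀ (chain-start≢root k≥1 chain , x₀≢ρ , w~x₀))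
    where
    k<depth-w : k < depth w
    k<depth-w = subst (k <_) (sym depth-w) (m<m+n k (≢root⇒depth>0 z≢ρ))

    w~x₀ : branch w ≡ branch x₀
    w~x₀ = trans (sym (branch-ancestor k w k<depth-w)) (trans (cong branch w↑) z~x₀)

  root-chain : Chain k x₀ ρ
  root-chain =
    depth≡0⇒root (trans (depth-link ≤-refl) (n∸n≡0 k)) ,
    trans depth-x₀ (sym (trans (cong (k +_) depth-root) (+-identityʳ k))) ,
    free
    where
    depth-link : ∀ {i} → i ≤ k → depth (ancestor i x₀) ≡ k ∸ i
    depth-link {i} i≤k = trans (depth-ancestor i x₀ (subst (i ≤_) (sym depth-x₀) i≤k)) (cong (_∸ i) depth-x₀)

    free : ∀ i → 0 < i → i < k → height (ancestor i x₀) ≢ k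
    free i _ i<k = no-hub-beside-x₀ (link≢ρ , x₀≢ρ , branch-ancestor i x₀ (subst (i <_) (sym depth-x₀) i<k))
      where link≢ρ = depth>0⇒≢root (subst (0 <_) (sym (depth-link (<⇒≤ i<k))) (m<n⇒0<n∸m i<k))

  root-degree : DegAtLeast S ρ (suc k)
  root-degree = extend-degree {E = S} (chain-links (inj₁ refl) root-chain) (inj₂ (c≢ρ , c↑)) fresh
    where
    c = branch y₀
    c≢ρ = depth>0⇒≢root (≤-reflexive (sym (depth-branch y₀≢ρ)))
    c↑ = trans (up-anchor c≢ρ (inj₁ (parent-branch y₀≢ρ))) (parent-branch y₀≢ρ)

    fresh : ∀ i → ancestor (toℕ i) x₀ ≢ c
    fresh i link≡c = x₀-y₀-apart (x₀≢ρ , y₀≢ρ , (begin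
      branch x₀                     ≡⟨ branch-ancestor (toℕ i) x₀ (subst (toℕ i <_) (sym depth-x₀) (toℕ<n i)) ⟨
      branch (ancestor (toℕ i) x₀)  ≡⟨ cong branch link≡c ⟩
      branch (branch y₀)            ≡⟨ branch-branch y₀≢ρ ⟩
      branch y₀                     ∎))
      where open ≡-Reasoning

m≤n∸1⇒m<n : ∀ {m n} → 0 < m → m ≤ n ∸ 1 → m < n
m≤n∸1⇒m<n {n = zero} 0<m m≤0 = case ≤-trans 0<m m≤0 of λ ()
m≤n∸1⇒m<n {n = suc n} _ m≤n = s≤s m≤n

lemma3 : ∀ {n} (T : Rel n) → IsTree T → (d : ℕ) → Diameter T d →
         (k : ℕ) → 1 ≤ k → k ≤ d ∸ 1 →
         ∃[ S ] (IsTree S × Subgraph S (Power T k) × Branching (suc k) S)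
lemma3 T tree d diameter k k≥1 k≤d∸1 = S , S-tree , S-power , S-branching root-degree
  where
  k<d = m≤n∸1⇒m<n k≥1 k≤d∸1

  open DiametralRoot tree k (d ∸ k) k≥1 (m<n⇒0<n∸m k<d)
                 (subst (Diameter T) (sym (m+[n∸m]≡n (<⇒≤ k<d))) diameter)
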